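{- Let $n\ge2$, let $f'=f'_1\cdots f'_{n-1}\in F_{n-1}^{\nearrow}$, let $j$ be an integer with $f'_{n-1}\le j\le n$, and let $f=f'_1\cdots f'_{n-1}\,j\in F_n^{\nearrow}$. Write $\mathrm{Flip}(f')=g_1\cdots g_{n-1}$. Then $\mathrm{Flip}(f)=1\,h_1h_2\cdots h_{n-1}$, where $h_i=g_i$ for $1\le i\le n-j$ and $h_i=g_i+1$ for $n-j<i\le n-1$ (i.e., $\mathrm{Flip}(f)$ is obtained from $\mathrm{Flip}(f')$ by adding $1$ to the entries in the last $j-1$ positions and inserting a $1$ at the beginning).
   Context: A function $f:[n]\to[n]$ is subexceedant if $1\le f(i)\le i$ for all $i$, written $f_1\cdots f_n$; $F_n^{\nearrow}$ is the set of non-decreasing subexceedant functions on $[n]$. For $f\in F_n^{\nearrow}$, its $r$-vector is $(r_1,\dots,r_n)$ with $r_k$ the number of indices $i$ with $f_i=k$. The map $\mathrm{Flip}:F_n^{\nearrow}\to F_n^{\nearrow}$ is defined by $\mathrm{Flip}(f)=f'_1\cdots f'_n$ with $f'_i=n+1-\sum_{k=1}^{n-i+1}r_k$. -}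

module Defs where

open import Data.Nat using (ℕ; zero; suc; _+_; _∸_; _≤_)
open import Data.Nat.Properties using (_≟_)
open import Data.Fin using (Fin; toℕ) renaming (_≤_ to _≤ᶠ_)
open import Data.Vec using (Vec; lookup; tabulate; count)
open import Data.Product using (_×_)

-- A function f : [n] → [n] is encoded as a vector f of length n,
-- with  lookup f i  = f_{i+1}  (0-based position i, 1-based values).

IsSubexceedant : (n : ℕ) → Vec ℕ n → Set
IsSubexceedant n f = ∀ (i : Fin n) → 1 ≤ lookup f i × lookup f i ≤ suc (toℕ i)

IsNonDecreasing : (n : ℕ) → Vec ℕ n → Set
IsNonDecreasing n f = ∀ (i i' : Fin n) → i ≤ᶠ i' → lookup f i ≤ lookup f i'

InF↗ : (n : ℕ) → Vec ℕ n → Set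
InF↗ n f = IsSubexceedant n f × IsNonDecreasing n f

r : {n : ℕ} → Vec ℕ n → ℕ → ℕ
r f k = count (_≟ k) f

rSum : {n : ℕ} → Vec ℕ n → ℕ → ℕ
rSum f zero = 0
rSum f (suc m) = rSum f m + r f (suc m)

-- Flip(f)_i = n + 1 - Σ_{k=1}^{n-i+1} r_k ; at 0-based position i the
-- 1-based index is i+1, so the upper limit is n - i.
-- (The sum is at most n, so truncated subtraction is exact.)
Flip : (n : ℕ) → Vec ℕ n → Vec ℕ n
Flip n f = tabulate (λ i → suc n ∸ rSum f (n ∸ toℕ i))

{-# OPTIONS --safe #-}
module Submission where

-- Appending the entry j to f' adds one to r_j and changes no other r_k, so the partial
-- sum Σ_{k ≤ m} r_k grows by one exactly when j ≤ m. Entry i+1 of Flip(f) and entry i of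
-- Flip(f') both read the partial sum up to n − i, subtracted from n + 1 and from n
-- respectively; hence h_i = g_i when j ≤ n − i and h_i = g_i + 1 otherwise. The first
-- entry of Flip(f) reads the full sum, which is n.

open import Defs
open import Level using (Level)
open import Data.Nat using (ℕ; zero; suc; _+_; _∸_; _≤_; _<_; z≤n; s≤s; s≤s⁻¹)
open import Data.Nat.Properties
open import Algebra.Properties.CommutativeSemigroup +-commutativeSemigroup using (interchange)
open import Data.Fin using (Fin; toℕ; fromℕ) renaming (zero to fzero; suc to fsuc)
open import Data.Fin.Properties using (toℕ<n)
open import Data.Vec using (Vec; lookup; last; _∷ʳ_; _∷_; []; [_]; count)
open import Data.Vec.Properties using (lookup∘tabulate)
open import Data.Product using (_×_; _,_; proj₁; map₂; uncurry)
open import Data.Sum using (inj₁; inj₂)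
open import Data.Bool using (true; false)
open import Relation.Unary using (Pred; Decidable)
open import Relation.Nullary using (¬_; does)
open import Relation.Nullary.Decidable using (dec-true; dec-false)
open import Relation.Binary.PropositionalEquality using (_≡_; refl; sym; cong; cong₂; subst; module ≡-Reasoning)
open ≡-Reasoning

private
  variable
    a p : Level
    A : Set a
    n m m′ y : ℕ

module _ {P : Pred A p} (P? : Decidable P) where

  count-∷ : ∀ x (xs : Vec A n) → count P? (x ∷ xs) ≡ count P? [ x ] + count P? xs
  count-∷ x xs with does (P? x)
  ... | true  = refl
  ... | false = refl

  count-[x]-yes : ∀ {x} → P x → count P? [ x ] ≡ 1
  count-[x]-yes {x} px rewrite dec-true (P? x) px = refl

  count-[x]-no : ∀ {x} → ¬ P x → count P? [ x ] ≡ 0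
  count-[x]-no {x} ¬px rewrite dec-false (P? x) ¬px = refl

last≡lookup-fromℕ : (xs : Vec A (suc n)) → last xs ≡ lookup xs (fromℕ n)
last≡lookup-fromℕ {n = zero}  (x ∷ [])     = refl
last≡lookup-fromℕ {n = suc n} (x ∷ y ∷ xs) = last≡lookup-fromℕ (y ∷ xs)

rSum-[] : ∀ m → rSum [] m ≡ 0
rSum-[] zero    = refl
rSum-[] (suc m) = cong (_+ 0) (rSum-[] m)

rSum-∷ : ∀ x (xs : Vec ℕ n) m → rSum (x ∷ xs) m ≡ rSum [ x ] m + rSum xs m
rSum-∷ x xs zero    = refl
rSum-∷ x xs (suc m) = begin
  rSum (x ∷ xs) m + r (x ∷ xs) (suc m)
    ≡⟨ cong₂ _+_ (rSum-∷ x xs m) (count-∷ (_≟ suc m) x xs) ⟩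
  (rSum [ x ] m + rSum xs m) + (r [ x ] (suc m) + r xs (suc m))
    ≡⟨ interchange (rSum [ x ] m) (rSum xs m) (r [ x ] (suc m)) (r xs (suc m)) ⟩
  rSum [ x ] (suc m) + rSum xs (suc m) ∎

rSum-∷ʳ : (xs : Vec ℕ n) (y m : ℕ) → rSum (xs ∷ʳ y) m ≡ rSum xs m + rSum [ y ] m
rSum-∷ʳ []       y m = cong (_+ rSum [ y ] m) (sym (rSum-[] m))
rSum-∷ʳ (x ∷ xs) y m = begin
  rSum (x ∷ (xs ∷ʳ y)) m                       ≡⟨ rSum-∷ x (xs ∷ʳ y) m ⟩
  rSum [ x ] m + rSum (xs ∷ʳ y) m              ≡⟨ cong (rSum [ x ] m +_) (rSum-∷ʳ xs y m) ⟩
  rSum [ x ] m + (rSum xs m + rSum [ y ] m)    ≡⟨ +-assoc (rSum [ x ] m) (rSum xs m) (rSum [ y ] m) ⟨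
  (rSum [ x ] m + rSum xs m) + rSum [ y ] m    ≡⟨ cong (_+ rSum [ y ] m) (rSum-∷ x xs m) ⟨
  rSum (x ∷ xs) m + rSum [ y ] m               ∎

rSum-singleton-above : m < y → rSum [ y ] m ≡ 0
rSum-singleton-above {zero}  _   = refl
rSum-singleton-above {suc m} m<y =
  cong₂ _+_ (rSum-singleton-above (<⇒≤ m<y)) (count-[x]-no (_≟ suc m) (λ y≡m → <⇒≢ m<y (sym y≡m)))

rSum-singleton-within : 1 ≤ y → y ≤ m → rSum [ y ] m ≡ 1
rSum-singleton-within {m = zero} (s≤s z≤n) ()
rSum-singleton-within {m = suc m} 1≤y y≤1+m with m≤n⇒m<n∨m≡n y≤1+m
... | inj₁ y<1+m = cong₂ _+_ (rSum-singleton-within 1≤y (s≤s⁻¹ y<1+m))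
                             (count-[x]-no (_≟ suc m) (<⇒≢ y<1+m))
... | inj₂ refl  = cong₂ _+_ (rSum-singleton-above (n<1+n m)) (count-[x]-yes (_≟ suc m) refl)

rSum-mono : (xs : Vec ℕ n) → m ≤ m′ → rSum xs m ≤ rSum xs m′
rSum-mono {m′ = zero}   xs z≤n = ≤-refl
rSum-mono {m′ = suc m′} xs m≤m′ with m≤n⇒m<n∨m≡n m≤m′
... | inj₁ m<1+m′ = ≤-trans (rSum-mono xs (s≤s⁻¹ m<1+m′)) (m≤m+n _ _)
... | inj₂ refl   = ≤-refl

rSum-all-within : (xs : Vec ℕ n) → (∀ i → 1 ≤ lookup xs i × lookup xs i ≤ m) → rSum xs m ≡ n
rSum-all-within {m = m} []       _      = rSum-[] m
rSum-all-within {m = m} (x ∷ xs) within = begin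
  rSum (x ∷ xs) m          ≡⟨ rSum-∷ x xs m ⟩
  rSum [ x ] m + rSum xs m ≡⟨ cong₂ _+_ (uncurry rSum-singleton-within (within fzero))
                                        (rSum-all-within xs (λ i → within (fsuc i))) ⟩
  suc _                    ∎

rSum-subexceedant : {f : Vec ℕ n} → IsSubexceedant n f → n ≤ m → rSum f m ≡ n
rSum-subexceedant {f = f} sub n≤m =
  rSum-all-within f (λ i → map₂ (λ fᵢ≤1+i → ≤-trans fᵢ≤1+i (≤-trans (toℕ<n i) n≤m)) (sub i))

lookup-Flip : (f : Vec ℕ n) (i : Fin n) → lookup (Flip n f) i ≡ suc n ∸ rSum f (n ∸ toℕ i)
lookup-Flip {n} f = lookup∘tabulate (λ i → suc n ∸ rSum f (n ∸ toℕ i))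

Flip-∷ʳ-head : {f : Vec ℕ n} → IsSubexceedant n f → 1 ≤ y → y ≤ suc n →
               lookup (Flip (suc n) (f ∷ʳ y)) fzero ≡ 1
Flip-∷ʳ-head {n} {y} {f} sub 1≤y y≤1+n = begin
  lookup (Flip (suc n) (f ∷ʳ y)) fzero              ≡⟨ lookup-Flip (f ∷ʳ y) fzero ⟩
  suc (suc n) ∸ rSum (f ∷ʳ y) (suc n)               ≡⟨ cong (suc (suc n) ∸_) (rSum-∷ʳ f y (suc n)) ⟩
  suc (suc n) ∸ (rSum f (suc n) + rSum [ y ] (suc n))
    ≡⟨ cong (suc (suc n) ∸_) (cong₂ _+_ (rSum-subexceedant sub (n≤1+n n)) (rSum-singleton-within 1≤y y≤1+n)) ⟩
  suc (suc n) ∸ (n + 1)                             ≡⟨ cong (suc (suc n) ∸_) (+-comm n 1) ⟩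
  suc n ∸ n                                         ≡⟨ m+n∸n≡m 1 n ⟩
  1                                                 ∎

Flip-∷ʳ-below : (f : Vec ℕ n) (i : Fin n) → 1 ≤ y → y ≤ n ∸ toℕ i →
                lookup (Flip (suc n) (f ∷ʳ y)) (fsuc i) ≡ lookup (Flip n f) i
Flip-∷ʳ-below {n} {y} f i 1≤y y≤k = begin
  lookup (Flip (suc n) (f ∷ʳ y)) (fsuc i)           ≡⟨ lookup-Flip (f ∷ʳ y) (fsuc i) ⟩
  suc (suc n) ∸ rSum (f ∷ʳ y) k                     ≡⟨ cong (suc (suc n) ∸_) (rSum-∷ʳ f y k) ⟩
  suc (suc n) ∸ (rSum f k + rSum [ y ] k)           ≡⟨ cong (λ c → suc (suc n) ∸ (rSum f k + c)) (rSum-singleton-within 1≤y y≤k) ⟩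
  suc (suc n) ∸ (rSum f k + 1)                      ≡⟨ cong (suc (suc n) ∸_) (+-comm (rSum f k) 1) ⟩
  suc n ∸ rSum f k                                  ≡⟨ lookup-Flip f i ⟨
  lookup (Flip n f) i                               ∎
  where
  k : ℕ
  k = n ∸ toℕ i

Flip-∷ʳ-above : {f : Vec ℕ n} → IsSubexceedant n f → (i : Fin n) → n ∸ toℕ i < y →
                lookup (Flip (suc n) (f ∷ʳ y)) (fsuc i) ≡ suc (lookup (Flip n f) i)
Flip-∷ʳ-above {n} {y} {f} sub i k<y = begin
  lookup (Flip (suc n) (f ∷ʳ y)) (fsuc i)           ≡⟨ lookup-Flip (f ∷ʳ y) (fsuc i) ⟩
  suc (suc n) ∸ rSum (f ∷ʳ y) k                     ≡⟨ cong (suc (suc n) ∸_) (rSum-∷ʳ f y k) ⟩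
  suc (suc n) ∸ (rSum f k + rSum [ y ] k)           ≡⟨ cong (λ c → suc (suc n) ∸ (rSum f k + c)) (rSum-singleton-above k<y) ⟩
  suc (suc n) ∸ (rSum f k + 0)                      ≡⟨ cong (suc (suc n) ∸_) (+-identityʳ (rSum f k)) ⟩
  suc (suc n) ∸ rSum f k                            ≡⟨ +-∸-assoc 1 (≤-trans rSum-f-k≤n (n≤1+n n)) ⟩
  suc (suc n ∸ rSum f k)                            ≡⟨ cong suc (lookup-Flip f i) ⟨
  suc (lookup (Flip n f) i)                         ∎
  where
  k : ℕ
  k = n ∸ toℕ i
  rSum-f-k≤n : rSum f k ≤ n
  rSum-f-k≤n = ≤-trans (rSum-mono f (m∸n≤m n (toℕ i))) (≤-reflexive (rSum-subexceedant sub ≤-refl))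

suc≤∸⇒≤∸ : ∀ {i j n} → j ≤ suc n → suc i ≤ suc n ∸ j → j ≤ n ∸ i
suc≤∸⇒≤∸ {i} {j} {n} j≤1+n 1+i≤ =
  m+n≤o⇒m≤o∸n j (subst (_≤ n) (+-comm i j) (s≤s⁻¹ (m≤o∸n⇒m+n≤o (suc i) j≤1+n 1+i≤)))

∸<suc⇒∸< : ∀ {i j n} → i ≤ n → suc n ∸ j < suc i → n ∸ i < j
∸<suc⇒∸< {i} {j} {n} i≤n ∸<1+i = ≰⇒> λ j≤ →
  <⇒≱ ∸<1+i (m+n≤o⇒m≤o∸n (suc i) (s≤s (subst (_≤ n) (+-comm j i) (m≤o∸n⇒m+n≤o j i≤n j≤))))

lemma5p3 : (k : ℕ) (f' : Vec ℕ (suc k)) → InF↗ (suc k) f' →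
    (j : ℕ) → last f' ≤ j → j ≤ suc (suc k) →
    lookup (Flip (suc (suc k)) (f' ∷ʳ j)) fzero ≡ 1 ×
    (∀ (i : Fin (suc k)) →
      (suc (toℕ i) ≤ suc (suc k) ∸ j →
        lookup (Flip (suc (suc k)) (f' ∷ʳ j)) (fsuc i) ≡ lookup (Flip (suc k) f') i) ×
      (suc (suc k) ∸ j < suc (toℕ i) →
        lookup (Flip (suc (suc k)) (f' ∷ʳ j)) (fsuc i) ≡ suc (lookup (Flip (suc k) f') i)))
lemma5p3 k f' (sub , _) j last≤j j≤ =
  Flip-∷ʳ-head sub 1≤j j≤ , λ i →
    (λ low  → Flip-∷ʳ-below f' i 1≤j (suc≤∸⇒≤∸ j≤ low)) ,
    (λ high → Flip-∷ʳ-above sub i (∸<suc⇒∸< (<⇒≤ (toℕ<n i)) high))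
  where
  1≤j : 1 ≤ j
  1≤j = ≤-trans (subst (1 ≤_) (sym (last≡lookup-fromℕ f')) (proj₁ (sub (fromℕ k)))) last≤j
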